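{- Let $\mu$ and $\nu$ be distinct strict partitions of the same integer $n$. Let $r$ be the largest integer such that $\mu_r\neq\nu_r$, and assume $\mu_r<\nu_r$. Put $m=r+\nu_r$. Then $\nu_1\ge m-1$ and $\mu_1>m-1$.
   Context: A partition is an infinite weakly decreasing sequence $\mu_1\ge\mu_2\ge\cdots$ of nonnegative integers with finitely many nonzero terms; its weight is the sum of its parts. A partition is strict if its nonzero parts are pairwise distinct. -}

module Defs where

open import Data.Nat using (ℕ; zero; suc; _+_; _∸_; _≤_; _<_; _≥_)
open import Data.Product using (Σ; _×_; ∃)
open import Relation.Nullary using (¬_)
open import Relation.Binary.PropositionalEquality using (_≡_; _≢_)

sumBelow : ℕ → (ℕ → ℕ) → ℕ
sumBelow zero    f = 0
sumBelow (suc N) f = sumBelow N f + f N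

-- A partition: an infinite weakly decreasing sequence of naturals with
-- finitely many nonzero terms.  Stored 0-indexed internally: the paper's
-- μ_i (i ≥ 1) is  part (i ∸ 1), accessed as  μ ‼ i.
record Partition : Set where
  field
    part       : ℕ → ℕ
    decreasing : ∀ i → part (suc i) ≤ part i
    finite     : ∃ λ N → ∀ i → N ≤ i → part i ≡ 0
open Partition public

_‼_ : Partition → ℕ → ℕ
μ ‼ i = part μ (i ∸ 1)

Weight : Partition → ℕ → Set
Weight μ n = Σ ℕ λ N → (∀ i → N ≤ i → part μ i ≡ 0) × sumBelow N (part μ) ≡ n

Strict : Partition → Set
Strict μ = ∀ i j → i ≢ j → part μ i ≢ 0 → part μ i ≢ part μ j

Distinct : Partition → Partition → Set
Distinct μ ν = ¬ (∀ i → part μ i ≡ part ν i)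

module Submission where

-- Proof idea.  Work with the 0-indexed parts p_i = part p i, so that the
-- paper's r is k + 1 and the claim reads  k + ν_k ≤ ν_0  and  k + ν_k < μ_0.
--
-- (1) In a strict partition the parts strictly decrease as long as they are
--     nonzero, hence  i ↦ i + p_i  is weakly decreasing on the support
--     (support-gap).  Taking i = 0 and j = k gives the bound on ν_0.
-- (2) Two partitions of the same weight whose parts agree from position r on
--     have equal sums of their first r parts (equal-weight-prefix, built on
--     the splitting and stabilisation lemmas for finite sums).
-- (3) If μ_0 ≤ k + ν_k, then support-gap for μ and ν gives μ_i ≤ ν_i for all
--     i ≤ k (dominated-prefix); together with μ_k < ν_k the first k + 1 parts
--     of μ sum to strictly less than those of ν, contradicting (2).
--     Hence k + ν_k < μ_0.

open import Defs
open import Data.Nat using (ℕ; zero; suc; _+_; _∸_; _≤_; _<_; _≥_; z≤n; s≤s; _≤′_; ≤′-refl; ≤′-step)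
open import Data.Nat.Properties
open import Data.Product using (Σ; _×_; _,_)
open import Data.Sum using (inj₁; inj₂)
open import Relation.Nullary using (yes; no; contradiction)
open import Relation.Binary.PropositionalEquality
  using (_≡_; _≢_; refl; sym; cong; cong₂; subst; module ≡-Reasoning)

sumBelow-cong : {f g : ℕ → ℕ} → (∀ i → f i ≡ g i) → ∀ k → sumBelow k f ≡ sumBelow k g
sumBelow-cong f≡g zero    = refl
sumBelow-cong f≡g (suc k) = cong₂ _+_ (sumBelow-cong f≡g k) (f≡g k)

sumBelow-mono : {f g : ℕ → ℕ} → ∀ k → (∀ i → i < k → f i ≤ g i) → sumBelow k f ≤ sumBelow k g
sumBelow-mono zero    f≤g = z≤n
sumBelow-mono (suc k) f≤g =
  +-mono-≤ (sumBelow-mono k (λ i i<k → f≤g i (m<n⇒m<1+n i<k))) (f≤g k ≤-refl)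

sumBelow-split : (f : ℕ → ℕ) (r t : ℕ) →
  sumBelow (r + t) f ≡ sumBelow r f + sumBelow t (λ i → f (r + i))
sumBelow-split f r zero = begin
  sumBelow (r + 0) f  ≡⟨ cong (λ m → sumBelow m f) (+-identityʳ r) ⟩
  sumBelow r f        ≡⟨ sym (+-identityʳ _) ⟩
  sumBelow r f + 0    ∎
  where open ≡-Reasoning
sumBelow-split f r (suc t) = begin
  sumBelow (r + suc t) f                                   ≡⟨ cong (λ m → sumBelow m f) (+-suc r t) ⟩
  sumBelow (r + t) f + f (r + t)                           ≡⟨ cong (_+ f (r + t)) (sumBelow-split f r t) ⟩
  sumBelow r f + sumBelow t (λ i → f (r + i)) + f (r + t)  ≡⟨ +-assoc (sumBelow r f) _ _ ⟩
  sumBelow r f + (sumBelow t (λ i → f (r + i)) + f (r + t)) ∎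
  where open ≡-Reasoning

sumBelow-stable : (f : ℕ → ℕ) (N : ℕ) → (∀ i → N ≤ i → f i ≡ 0) →
  ∀ {M} → N ≤′ M → sumBelow M f ≡ sumBelow N f
sumBelow-stable f N vanish ≤′-refl = refl
sumBelow-stable f N vanish (≤′-step {M} N≤′M) = begin
  sumBelow M f + f M  ≡⟨ cong (sumBelow M f +_) (vanish M (≤′⇒≤ N≤′M)) ⟩
  sumBelow M f + 0    ≡⟨ +-identityʳ _ ⟩
  sumBelow M f        ≡⟨ sumBelow-stable f N vanish N≤′M ⟩
  sumBelow N f        ∎
  where open ≡-Reasoning

weight-eventually : (μ : Partition) {n : ℕ} → Weight μ n →
  Σ ℕ λ N → ∀ M → N ≤ M → sumBelow M (part μ) ≡ n
weight-eventually μ (N , vanish , sum≡n) =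
  N , λ M N≤M → subst (sumBelow M (part μ) ≡_) sum≡n (sumBelow-stable (part μ) N vanish (≤⇒≤′ N≤M))

equal-weight-prefix : (μ ν : Partition) {n : ℕ} → Weight μ n → Weight ν n →
  ∀ r → (∀ i → r ≤ i → part μ i ≡ part ν i) → sumBelow r (part μ) ≡ sumBelow r (part ν)
equal-weight-prefix μ ν {n} wμ wν r tails-agree with weight-eventually μ wμ | weight-eventually ν wν
... | Nμ , sumμ | Nν , sumν = +-cancelʳ-≡ (tail ν) _ _ prefix+tail
  where
  M : ℕ
  M = r + (Nμ + Nν)

  tail : Partition → ℕ
  tail p = sumBelow (Nμ + Nν) (λ i → part p (r + i))

  tails-equal : tail μ ≡ tail ν
  tails-equal = sumBelow-cong (λ i → tails-agree (r + i) (m≤m+n r i)) (Nμ + Nν)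

  prefix+tail : sumBelow r (part μ) + tail ν ≡ sumBelow r (part ν) + tail ν
  prefix+tail = begin
    sumBelow r (part μ) + tail ν  ≡⟨ cong (sumBelow r (part μ) +_) (sym tails-equal) ⟩
    sumBelow r (part μ) + tail μ  ≡⟨ sym (sumBelow-split (part μ) r (Nμ + Nν)) ⟩
    sumBelow M (part μ)           ≡⟨ sumμ M (≤-trans (m≤m+n Nμ Nν) (m≤n+m _ r)) ⟩
    n                             ≡⟨ sym (sumν M (≤-trans (m≤n+m Nν Nμ) (m≤n+m _ r))) ⟩
    sumBelow M (part ν)           ≡⟨ sumBelow-split (part ν) r (Nμ + Nν) ⟩
    sumBelow r (part ν) + tail ν  ∎
    where open ≡-Reasoning

nonzero-before : (p : Partition) → ∀ j → part p (suc j) ≢ 0 → part p j ≢ 0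
nonzero-before p j nz p_j≡0 = nz (n≤0⇒n≡0 (subst (part p (suc j) ≤_) p_j≡0 (decreasing p j)))

strict-step : (p : Partition) → Strict p → ∀ j → part p (suc j) ≢ 0 → part p (suc j) < part p j
strict-step p p-strict j nz with m≤n⇒m<n∨m≡n (decreasing p j)
... | inj₁ lt = lt
... | inj₂ eq = contradiction eq (p-strict (suc j) j (λ ()) nz)

support-gap′ : (p : Partition) → Strict p → ∀ {i j} → i ≤′ j → part p j ≢ 0 →
  j + part p j ≤ i + part p i
support-gap′ p p-strict ≤′-refl nz = ≤-refl
support-gap′ p p-strict {i} (≤′-step {j} i≤′j) nz = begin
  suc j + part p (suc j)   ≡⟨ sym (+-suc j _) ⟩
  j + suc (part p (suc j)) ≤⟨ +-monoʳ-≤ j (strict-step p p-strict j nz) ⟩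
  j + part p j             ≤⟨ support-gap′ p p-strict i≤′j (nonzero-before p j nz) ⟩
  i + part p i             ∎
  where open ≤-Reasoning

support-gap : (p : Partition) → Strict p → ∀ {i j} → i ≤ j → part p j ≢ 0 →
  j + part p j ≤ i + part p i
support-gap p p-strict i≤j = support-gap′ p p-strict (≤⇒≤′ i≤j)

dominated-prefix : (μ ν : Partition) → Strict μ → Strict ν → ∀ k → part ν k ≢ 0 →
  part μ 0 ≤ k + part ν k → ∀ i → i ≤ k → part μ i ≤ part ν i
dominated-prefix μ ν strictμ strictν k ν_k≢0 μ₀≤ i i≤k with part μ i ≟ 0
... | yes μ_i≡0 = subst (_≤ part ν i) (sym μ_i≡0) z≤n
... | no μ_i≢0 = +-cancelˡ-≤ i _ _ (begin
  i + part μ i  ≤⟨ support-gap μ strictμ z≤n μ_i≢0 ⟩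
  part μ 0      ≤⟨ μ₀≤ ⟩
  k + part ν k  ≤⟨ support-gap ν strictν i≤k ν_k≢0 ⟩
  i + part ν i  ∎)
  where open ≤-Reasoning

lemma4 : (n : ℕ) (μ ν : Partition) → Strict μ → Strict ν → Weight μ n → Weight ν n →
    Distinct μ ν → (r : ℕ) → 1 ≤ r → μ ‼ r ≢ ν ‼ r → (∀ s → r < s → μ ‼ s ≡ ν ‼ s) →
    μ ‼ r < ν ‼ r →
    (ν ‼ 1 ≥ (r + ν ‼ r) ∸ 1) × ((r + ν ‼ r) ∸ 1 < μ ‼ 1)
-- Since 1 ≤ r we write r = suc k; then μ ‼ r = μ_k and ν ‼ r = ν_k.  The
-- hypotheses  Distinct μ ν  and  μ ‼ r ≢ ν ‼ r  are implied by μ_k < ν_k.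
lemma4 n μ ν strictμ strictν wμ wν _ (suc k) _ _ tails-agree μ_k<ν_k = ν₀-bound , μ₀-bound
  where
  ν_k≢0 : part ν k ≢ 0
  ν_k≢0 ν_k≡0 = n≮0 (subst (part μ k <_) ν_k≡0 μ_k<ν_k)

  ν₀-bound : k + part ν k ≤ part ν 0
  ν₀-bound = support-gap ν strictν z≤n ν_k≢0

  prefix-smaller : part μ 0 ≤ k + part ν k → sumBelow (suc k) (part μ) < sumBelow (suc k) (part ν)
  prefix-smaller μ₀≤ = +-mono-≤-< (sumBelow-mono k dominated) μ_k<ν_k
    where
    dominated : ∀ i → i < k → part μ i ≤ part ν i
    dominated i i<k = dominated-prefix μ ν strictμ strictν k ν_k≢0 μ₀≤ i (<⇒≤ i<k)

  prefix-equal : sumBelow (suc k) (part μ) ≡ sumBelow (suc k) (part ν)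
  prefix-equal = equal-weight-prefix μ ν wμ wν (suc k) (λ i k<i → tails-agree (suc i) (s≤s k<i))

  μ₀-bound : k + part ν k < part μ 0
  μ₀-bound = ≰⇒> (λ μ₀≤ → <-irrefl prefix-equal (prefix-smaller μ₀≤))
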